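{- Let $\mathcal{E}$ be a set of equations and $\mathcal{R}$ a set of rewrite rules over the terms described in the context, with $\sim$, $\to$, $\rhd\!\!\!\!\rhd$ as defined there, and assume $\mathcal{E}$ is linear. Then the following are equivalent: (a) $\to$ is confluent: for all $t,u,v$ with $t\to^*u$ and $t\to^*v$ there is $w$ with $u\to^*w$ and $v\to^*w$; (b) $\rhd\!\!\!\!\rhd$ is $\sim$-confluent: for all $t,u,v$ with $t\rhd\!\!\!\!\rhd^*u$ and $t\rhd\!\!\!\!\rhd^*v$ there are $u',v'$ with $u\rhd\!\!\!\!\rhd^*u'$, $v\rhd\!\!\!\!\rhd^*v'$ and $u'\sim v'$; (c) $\rhd\!\!\!\!\rhd$ is $\sim$-confluent on $\sim$-classes: for all $t,t',u,v$ with $t\rhd\!\!\!\!\rhd^*u$, $t\sim t'$ and $t'\rhd\!\!\!\!\rhd^*v$ there are $u',v'$ with $u\rhd\!\!\!\!\rhd^*u'$, $v\rhd\!\!\!\!\rhd^*v'$ and $u'\sim v'$.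
   Context: Terms (considered modulo renaming of bound variables): $t,u ::= s \mid x \mid f \mid [x:t]u \mid tu \mid (x:t)u$, where $s\in\{\star,\Box\}$ is a sort, $x$ ranges over an infinite set of variables, $f$ ranges over a set $\mathcal{F}$ of symbols, $[x:t]u$ is an abstraction (binding $x$ in $u$), $tu$ an application and $(x:t)u$ a dependent product (binding $x$ in $u$). Every symbol $f$ has an arity $\alpha_f\in\mathbb{N}$. A term is algebraic if it is built only from variables and applications $f t_1\ldots t_n$ with $n=\alpha_f$. $\mathrm{FV}(t)$ is the set of free variables of $t$; $t|_p$ is the subterm at position $p$ and $t[u]_p$ the replacement of $t|_p$ by $u$. A rewrite rule is a pair $l\to r$ of terms with $l$ algebraic, $l$ not a variable, and $\mathrm{FV}(r)\subseteq\mathrm{FV}(l)$. For a set of rules $\mathcal{R}$, $t\to_{\mathcal{R}} t'$ iff there are a position $p$, a rule $l\to r\in\mathcal{R}$ and a substitution $\sigma$ with $t|_p=l\sigma$ and $t'=t[r\sigma]_p$. $t\to_\beta t'$ iff there is a position $p$ with $t|_p=([x:U]v)\,u$ and $t'=t[v\{x\mapsto u\}]_p$. A set of equations $\mathcal{E}$ is a set of rewrite rules that is symmetric ($l\to r\in\mathcal{E}$ iff $r\to l\in\mathcal{E}$), such that for each $l\to r\in\mathcal{E}$ both $l$ and $r$ are algebraic, headed by a symbol, and $\mathrm{FV}(l)=\mathrm{FV}(r)$. $\mathcal{E}$ is linear if in every rule of $\mathcal{E}$ no variable occurs more than once in the left-hand side and no variable occurs more than once in the right-hand side. $\sim$ is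 the reflexive and transitive closure of $\to_{\mathcal{E}}$. $\to$ denotes $\to_\beta\cup\to_{\mathcal{R}}\cup\to_{\mathcal{E}}$. $t\rhd\!\!\!\!\rhd u$ iff $t\to_\beta u$, or there exists $t'$ with $t\sim t'$ and $t'\to_{\mathcal{R}} u$. $S^*$ is the reflexive and transitive closure of a relation $S$. -}

module Defs where

open import Data.Nat using (ℕ; zero; suc; _+_; _≤_)
open import Data.Nat.Properties using (_≟_)
open import Data.List using (List; []; _∷_; length)
open import Data.List.Relation.Unary.All using (All)
open import Data.Product using (Σ; ∃; _×_; _,_)
open import Data.Sum using (_⊎_)
open import Relation.Nullary using (¬_; yes; no)
open import Relation.Binary.PropositionalEquality using (_≡_)
open import Relation.Binary.Construct.Closure.ReflexiveTransitive using (Star)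
open import Function.Bundles using (_⇔_)

data Sort : Set where
  star box : Sort

-- Terms over a set F of symbols, with variables as de Bruijn indices
-- (so terms are taken modulo renaming of bound variables).
--   lam A u  =  [x:A]u      (binds index 0 in u)
--   app t u  =  t u
--   pi A u   =  (x:A)u      (binds index 0 in u)
data Term (F : Set) : Set where
  sort : Sort → Term F
  var  : ℕ → Term F
  sym  : F → Term F
  lam  : Term F → Term F → Term F
  app  : Term F → Term F → Term F
  pi   : Term F → Term F → Term F

module _ {F : Set} where

  ext : (ℕ → ℕ) → ℕ → ℕ
  ext ρ zero = zero
  ext ρ (suc n) = suc (ρ n)

  rename : (ℕ → ℕ) → Term F → Term F
  rename ρ (sort s) = sort s
  rename ρ (var x) = var (ρ x)
  rename ρ (sym f) = sym f
  rename ρ (lam A u) = lam (rename ρ A) (rename (ext ρ) u)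
  rename ρ (app t u) = app (rename ρ t) (rename ρ u)
  rename ρ (pi A u) = pi (rename ρ A) (rename (ext ρ) u)

  exts : (ℕ → Term F) → ℕ → Term F
  exts σ zero = var zero
  exts σ (suc n) = rename suc (σ n)

  subst : (ℕ → Term F) → Term F → Term F
  subst σ (sort s) = sort s
  subst σ (var x) = σ x
  subst σ (sym f) = sym f
  subst σ (lam A u) = lam (subst σ A) (subst (exts σ) u)
  subst σ (app t u) = app (subst σ t) (subst σ u)
  subst σ (pi A u) = pi (subst σ A) (subst (exts σ) u)

  single : Term F → ℕ → Term F
  single u zero = u
  single u (suc n) = var n

  _[_] : Term F → Term F → Term F
  v [ u ] = subst (single u) v

  data _∈FV_ : ℕ → Term F → Set where
    fv-var  : ∀ {x} → x ∈FV var x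
    fv-lamA : ∀ {x A u} → x ∈FV A → x ∈FV lam A u
    fv-lamB : ∀ {x A u} → suc x ∈FV u → x ∈FV lam A u
    fv-appL : ∀ {x t u} → x ∈FV t → x ∈FV app t u
    fv-appR : ∀ {x t u} → x ∈FV u → x ∈FV app t u
    fv-piA  : ∀ {x A u} → x ∈FV A → x ∈FV pi A u
    fv-piB  : ∀ {x A u} → suc x ∈FV u → x ∈FV pi A u

  occVar : ℕ → ℕ → ℕ
  occVar x y with x ≟ y
  ... | yes _ = 1
  ... | no _ = 0

  occ : ℕ → Term F → ℕ
  occ x (sort s) = 0
  occ x (var y) = occVar x y
  occ x (sym f) = 0
  occ x (lam A u) = occ x A + occ (suc x) u
  occ x (app t u) = occ x t + occ x u
  occ x (pi A u) = occ x A + occ (suc x) u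

  apps : Term F → List (Term F) → Term F
  apps h [] = h
  apps h (t ∷ ts) = apps (app h t) ts

  data Algebraic (arity : F → ℕ) : Term F → Set where
    alg-var : ∀ x → Algebraic arity (var x)
    alg-fun : ∀ f (ts : List (Term F)) → length ts ≡ arity f →
              All (Algebraic arity) ts → Algebraic arity (apps (sym f) ts)

  IsVar : Term F → Set
  IsVar t = ∃ λ x → t ≡ var x

  HeadedBySymbol : Term F → Set
  HeadedBySymbol t = Σ F λ f → ∃ λ ts → t ≡ apps (sym f) ts

  Rules : Set₁
  Rules = Term F → Term F → Set

  IsRewriteRules : (F → ℕ) → Rules → Set
  IsRewriteRules arity R = ∀ l r → R l r →
    Algebraic arity l × ¬ IsVar l × (∀ x → x ∈FV r → x ∈FV l)

  IsEquations : (F → ℕ) → Rules → Set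
  IsEquations arity E =
    IsRewriteRules arity E ×
    (∀ l r → E l r → E r l) ×
    (∀ l r → E l r → Algebraic arity l × Algebraic arity r ×
                     HeadedBySymbol l × HeadedBySymbol r ×
                     (∀ x → (x ∈FV l) ⇔ (x ∈FV r)))

  LinearEqs : Rules → Set
  LinearEqs E = ∀ l r → E l r → (∀ x → occ x l ≤ 1) × (∀ x → occ x r ≤ 1)

  -- closure of a relation under all term contexts
  -- (t|_p = a, t' = t[b]_p, for some position p)
  data Ctx (B : Term F → Term F → Set) : Term F → Term F → Set where
    top  : ∀ {a b} → B a b → Ctx B a b
    lamA : ∀ {A A' u} → Ctx B A A' → Ctx B (lam A u) (lam A' u)
    lamB : ∀ {A u u'} → Ctx B u u' → Ctx B (lam A u) (lam A u')
    appL : ∀ {t t' u} → Ctx B t t' → Ctx B (app t u) (app t' u)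
    appR : ∀ {t u u'} → Ctx B u u' → Ctx B (app t u) (app t u')
    piA  : ∀ {A A' u} → Ctx B A A' → Ctx B (pi A u) (pi A' u)
    piB  : ∀ {A u u'} → Ctx B u u' → Ctx B (pi A u) (pi A u')

  RootStep : Rules → Term F → Term F → Set
  RootStep R a b = Σ (Term F) λ l → Σ (Term F) λ r → Σ (ℕ → Term F) λ σ →
    R l r × a ≡ subst σ l × b ≡ subst σ r

  RootBeta : Term F → Term F → Set
  RootBeta a b = Σ (Term F) λ U → Σ (Term F) λ v → Σ (Term F) λ u →
    a ≡ app (lam U v) u × b ≡ v [ u ]

  _⟶[_]_ : Term F → Rules → Term F → Set
  t ⟶[ R ] t' = Ctx (RootStep R) t t'

  _⟶β_ : Term F → Term F → Set
  t ⟶β t' = Ctx RootBeta t t'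

  Sim : Rules → Term F → Term F → Set
  Sim E = Star (λ t t' → t ⟶[ E ] t')

  Arrow : Rules → Rules → Term F → Term F → Set
  Arrow E R t t' = (t ⟶β t') ⊎ (t ⟶[ R ] t') ⊎ (t ⟶[ E ] t')

  Rhd : Rules → Rules → Term F → Term F → Set
  Rhd E R t u = (t ⟶β u) ⊎ (Σ (Term F) λ t' → Sim E t t' × t' ⟶[ R ] u)

  ArrowConfluent : Rules → Rules → Set
  ArrowConfluent E R = ∀ t u v →
    Star (Arrow E R) t u → Star (Arrow E R) t v →
    Σ (Term F) λ w → Star (Arrow E R) u w × Star (Arrow E R) v w

  RhdSimConfluent : Rules → Rules → Set
  RhdSimConfluent E R = ∀ t u v →
    Star (Rhd E R) t u → Star (Rhd E R) t v →
    Σ (Term F) λ u' → Σ (Term F) λ v' →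
      Star (Rhd E R) u u' × Star (Rhd E R) v v' × Sim E u' v'

  RhdSimConfluentOnClasses : Rules → Rules → Set
  RhdSimConfluentOnClasses E R = ∀ t t' u v →
    Star (Rhd E R) t u → Sim E t t' → Star (Rhd E R) t' v →
    Σ (Term F) λ u' → Σ (Term F) λ v' →
      Star (Rhd E R) u u' × Star (Rhd E R) v v' × Sim E u' v'

{-# OPTIONS --safe #-}
-- When E is linear, a β-step following an E-step can be performed first.
-- In lσ ~ rσ ⟶β c both sides of the equation are symbol-headed first-order
-- terms, so no β-redex overlaps them and the redex lies inside σ x for a
-- single variable x.  By linearity x occurs exactly once in r and, since
-- FV(l) = FV(r), exactly once in l; the same β-step thus turns lσ into lσ'
-- with lσ' ~ rσ' = c.  Hence ~ ; ⟶β ⊆ ⟶β ; ~, and since ▷▷ absorbs ~ in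
-- front of R-steps, ⟶* ⊆ ▷▷* ; ~ and ~ ; ▷▷* ⊆ ▷▷* ; ~.  These two
-- inclusions make the three confluence properties interderivable.
module Submission where

open import Defs
open import Data.Nat using (ℕ; zero; suc; _+_; _≤_; s≤s)
open import Data.Nat.Properties
  using (_≟_; ≤-antisym; ≤-trans; ≤-reflexive; +-comm; m≤m+n; m≤n+m; n≤0⇒n≡0; m+n≡0⇒m≡0; m+n≡0⇒n≡0; m+n≤o⇒m≤o; m+n≤o⇒n≤o)
open import Data.List.Relation.Unary.All using (All; []; _∷_)
open import Data.Product using (∃₂; ∃-syntax; _×_; _,_; proj₁; proj₂)
open import Data.Sum using (_⊎_; inj₁; inj₂)
open import Data.Empty using (⊥-elim)
open import Function using (_∘_)
open import Function.Bundles using (_⇔_; mk⇔; Equivalence)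
open import Relation.Nullary using (¬_; yes; no)
open import Relation.Binary.PropositionalEquality using (_≡_; _≢_; refl; trans; cong; cong₂) renaming (sym to ≡-sym)
open import Relation.Binary.Construct.Closure.ReflexiveTransitive
  using (Star; ε; _◅_; _◅◅_; gmap; map; reverse; return; _⋆)

module _ {F : Set} where

  mutual
    data Rigid : Term F → Set where
      head : ∀ f → Rigid (sym f)
      _·_  : ∀ {t u} → Rigid t → FirstOrder u → Rigid (app t u)

    data FirstOrder : Term F → Set where
      fvar  : ∀ x → FirstOrder (var x)
      rigid : ∀ {t} → Rigid t → FirstOrder t

  algebraic⇒firstOrder : ∀ {arity} {t : Term F} → Algebraic arity t → FirstOrder t
  algebraic⇒firstOrder (alg-var x) = fvar x
  algebraic⇒firstOrder {arity} (alg-fun f _ _ ts) = rigid (apps-rigid (head f) ts)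
    where
    apps-rigid : ∀ {h ts} → Rigid h → All (Algebraic arity) ts → Rigid (apps h ts)
    apps-rigid h [] = h
    apps-rigid h (t ∷ ts) = apps-rigid (h · algebraic⇒firstOrder t) ts

  firstOrder⇒rigid : ∀ {t : Term F} → FirstOrder t → ¬ IsVar t → Rigid t
  firstOrder⇒rigid (fvar x) t-nonvar = ⊥-elim (t-nonvar (x , refl))
  firstOrder⇒rigid (rigid t) _ = t

  rigid-subst≢lam : ∀ {t : Term F} → Rigid t → ∀ σ {U v} → subst σ t ≢ lam U v
  rigid-subst≢lam (head f) σ ()
  rigid-subst≢lam (t · u) σ ()

  app-injectiveˡ : ∀ {a b c d : Term F} → app a b ≡ app c d → a ≡ c
  app-injectiveˡ refl = refl

  rigid-subst≢redex : ∀ {t : Term F} → Rigid t → ∀ σ {U v w} → subst σ t ≢ app (lam U v) w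
  rigid-subst≢redex (head f) σ ()
  rigid-subst≢redex (rt · fu) σ eq = rigid-subst≢lam rt σ (app-injectiveˡ eq)

  subst-natural : (h : Term F → Term F) → (∀ f → h (sym f) ≡ sym f) →
                  (∀ a b → h (app a b) ≡ app (h a) (h b)) →
                  ∀ {t} → FirstOrder t → ∀ τ → h (subst τ t) ≡ subst (h ∘ τ) t
  subst-natural h h-sym h-app (fvar x) τ = refl
  subst-natural h h-sym h-app (rigid (head f)) τ = h-sym f
  subst-natural h h-sym h-app (rigid (rt · fu)) τ =
    trans (h-app _ _) (cong₂ app (subst-natural h h-sym h-app (rigid rt) τ)
                                 (subst-natural h h-sym h-app fu τ))

  Sim-single : ∀ {R : Rules {F}} {a b} → a ⟶[ R ] b → ∀ x → Sim R (single a x) (single b x)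
  Sim-single a⟶b zero = return a⟶b
  Sim-single a⟶b (suc x) = ε

  module _ {R : Rules {F}} (firstOrder-sides : ∀ {l r} → R l r → FirstOrder l × FirstOrder r) where

    RootStep-natural : (h : Term F → Term F) → (∀ f → h (sym f) ≡ sym f) →
                       (∀ a b → h (app a b) ≡ app (h a) (h b)) →
                       ∀ {a b} → RootStep R a b → RootStep R (h a) (h b)
    RootStep-natural h h-sym h-app (l , r , τ , e , refl , refl) =
      l , r , h ∘ τ , e ,
      subst-natural h h-sym h-app (proj₁ (firstOrder-sides e)) τ ,
      subst-natural h h-sym h-app (proj₂ (firstOrder-sides e)) τ

    ⟶-rename : ∀ ρ {a b} → a ⟶[ R ] b → rename ρ a ⟶[ R ] rename ρ b
    ⟶-rename ρ (top step) = top (RootStep-natural (rename ρ) (λ _ → refl) (λ _ _ → refl) step)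
    ⟶-rename ρ (lamA p) = lamA (⟶-rename ρ p)
    ⟶-rename ρ (lamB p) = lamB (⟶-rename (ext {F} ρ) p)
    ⟶-rename ρ (appL p) = appL (⟶-rename ρ p)
    ⟶-rename ρ (appR p) = appR (⟶-rename ρ p)
    ⟶-rename ρ (piA p) = piA (⟶-rename ρ p)
    ⟶-rename ρ (piB p) = piB (⟶-rename (ext {F} ρ) p)

    ⟶-subst : ∀ σ {a b} → a ⟶[ R ] b → subst σ a ⟶[ R ] subst σ b
    ⟶-subst σ (top step) = top (RootStep-natural (subst σ) (λ _ → refl) (λ _ _ → refl) step)
    ⟶-subst σ (lamA p) = lamA (⟶-subst σ p)
    ⟶-subst σ (lamB p) = lamB (⟶-subst (exts σ) p)
    ⟶-subst σ (appL p) = appL (⟶-subst σ p)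
    ⟶-subst σ (appR p) = appR (⟶-subst σ p)
    ⟶-subst σ (piA p) = piA (⟶-subst σ p)
    ⟶-subst σ (piB p) = piB (⟶-subst (exts σ) p)

    Sim-exts : ∀ {σ σ'} → (∀ x → Sim R (σ x) (σ' x)) → ∀ x → Sim R (exts σ x) (exts σ' x)
    Sim-exts σ~σ' zero = ε
    Sim-exts σ~σ' (suc x) = gmap (rename suc) (⟶-rename suc) (σ~σ' x)

    Sim-subst : ∀ {σ σ'} → (∀ x → Sim R (σ x) (σ' x)) → ∀ t → Sim R (subst σ t) (subst σ' t)
    Sim-subst σ~σ' (sort s) = ε
    Sim-subst σ~σ' (var x) = σ~σ' x
    Sim-subst σ~σ' (sym f) = ε
    Sim-subst {σ} {σ'} σ~σ' (lam A u) =
      gmap (λ z → lam z (subst (exts σ) u)) lamA (Sim-subst σ~σ' A) ◅◅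
      gmap (lam (subst σ' A)) lamB (Sim-subst (Sim-exts σ~σ') u)
    Sim-subst {σ} {σ'} σ~σ' (app t u) =
      gmap (λ z → app z (subst σ u)) appL (Sim-subst σ~σ' t) ◅◅
      gmap (app (subst σ' t)) appR (Sim-subst σ~σ' u)
    Sim-subst {σ} {σ'} σ~σ' (pi A u) =
      gmap (λ z → pi z (subst (exts σ) u)) piA (Sim-subst σ~σ' A) ◅◅
      gmap (pi (subst σ' A)) piB (Sim-subst (Sim-exts σ~σ') u)

  module _ {R : Rules {F}} (symmetric : ∀ l r → R l r → R r l) where

    ⟶-sym : ∀ {a b} → a ⟶[ R ] b → b ⟶[ R ] a
    ⟶-sym (top (l , r , σ , e , refl , refl)) = top (r , l , σ , symmetric l r e , refl , refl)
    ⟶-sym (lamA p) = lamA (⟶-sym p)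
    ⟶-sym (lamB p) = lamB (⟶-sym p)
    ⟶-sym (appL p) = appL (⟶-sym p)
    ⟶-sym (appR p) = appR (⟶-sym p)
    ⟶-sym (piA p) = piA (⟶-sym p)
    ⟶-sym (piB p) = piB (⟶-sym p)

    Sim-sym : ∀ {a b} → Sim R a b → Sim R b a
    Sim-sym = reverse ⟶-sym

  update : (ℕ → Term F) → ℕ → Term F → ℕ → Term F
  update σ x s y with x ≟ y
  ... | yes _ = s
  ... | no _ = σ y

  update-same : ∀ σ x s → update σ x s x ≡ s
  update-same σ x s with x ≟ x
  ... | yes _ = refl
  ... | no x≢x = ⊥-elim (x≢x refl)

  occVar-same : ∀ x → occVar {F} x x ≡ 1
  occVar-same x with x ≟ x
  ... | yes _ = refl
  ... | no x≢x = ⊥-elim (x≢x refl)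

  ∈FV⇒1≤occ : ∀ {x} {t : Term F} → x ∈FV t → 1 ≤ occ x t
  ∈FV⇒1≤occ {x} fv-var = ≤-reflexive (≡-sym (occVar-same x))
  ∈FV⇒1≤occ (fv-lamA p) = ≤-trans (∈FV⇒1≤occ p) (m≤m+n _ _)
  ∈FV⇒1≤occ (fv-lamB p) = ≤-trans (∈FV⇒1≤occ p) (m≤n+m _ _)
  ∈FV⇒1≤occ (fv-appL p) = ≤-trans (∈FV⇒1≤occ p) (m≤m+n _ _)
  ∈FV⇒1≤occ (fv-appR p) = ≤-trans (∈FV⇒1≤occ p) (m≤n+m _ _)
  ∈FV⇒1≤occ (fv-piA p) = ≤-trans (∈FV⇒1≤occ p) (m≤m+n _ _)
  ∈FV⇒1≤occ (fv-piB p) = ≤-trans (∈FV⇒1≤occ p) (m≤n+m _ _)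

  m+n≡1⇒m≡1∧n≡0∨m≡0∧n≡1 : ∀ m {n} → m + n ≡ 1 → (m ≡ 1 × n ≡ 0) ⊎ (m ≡ 0 × n ≡ 1)
  m+n≡1⇒m≡1∧n≡0∨m≡0∧n≡1 zero m+n≡1 = inj₂ (refl , m+n≡1)
  m+n≡1⇒m≡1∧n≡0∨m≡0∧n≡1 (suc zero) {zero} _ = inj₁ (refl , refl)

  1≤m⇒m+n≤1⇒n≡0 : ∀ {m n} → 1 ≤ m → m + n ≤ 1 → n ≡ 0
  1≤m⇒m+n≤1⇒n≡0 {suc m} _ (s≤s m+n≤0) = n≤0⇒n≡0 (m+n≤o⇒n≤o m m+n≤0)

  1≤n⇒m+n≤1⇒m≡0 : ∀ {m n} → 1 ≤ n → m + n ≤ 1 → m ≡ 0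
  1≤n⇒m+n≤1⇒m≡0 {m} {n} 1≤n m+n≤1 = 1≤m⇒m+n≤1⇒n≡0 1≤n (≤-trans (≤-reflexive (+-comm n m)) m+n≤1)

  subst-update-fresh : ∀ {t} → FirstOrder t → ∀ σ {x} s → occ x t ≡ 0 →
                       subst σ t ≡ subst (update σ x s) t
  subst-update-fresh (fvar y) σ {x} s never with x ≟ y
  subst-update-fresh (fvar y) σ {x} s () | yes _
  ... | no _ = refl
  subst-update-fresh (rigid (head f)) σ s never = refl
  subst-update-fresh {app t u} (rigid (rt · fu)) σ {x} s never =
    cong₂ app (subst-update-fresh (rigid rt) σ s (m+n≡0⇒m≡0 (occ x t) never))
              (subst-update-fresh fu σ s (m+n≡0⇒n≡0 (occ x t) never))

  ⟶β-update : ∀ {t} → FirstOrder t → ∀ σ {x s} → occ x t ≡ 1 → σ x ⟶β s →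
              subst σ t ⟶β subst (update σ x s) t
  ⟶β-update (fvar y) σ {x} once step with x ≟ y
  ... | yes refl = step
  ⟶β-update (fvar y) σ () step | no _
  ⟶β-update {app t u} (rigid (rt · fu)) σ {x} {s} once step with m+n≡1⇒m≡1∧n≡0∨m≡0∧n≡1 (occ x t) once
  ... | inj₁ (once-in-t , never-in-u) rewrite subst-update-fresh fu σ s never-in-u =
    appL (⟶β-update (rigid rt) σ once-in-t step)
  ... | inj₂ (never-in-t , once-in-u) rewrite subst-update-fresh (rigid rt) σ s never-in-t =
    appR (⟶β-update fu σ once-in-u step)

  Linear : Term F → Set
  Linear t = ∀ x → occ x t ≤ 1

  InnerβStep : (ℕ → Term F) → Term F → Term F → Set
  InnerβStep σ t c = ∃₂ λ x s → x ∈FV t × σ x ⟶β s × c ≡ subst (update σ x s) t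

  ⟶β-linear-instance : ∀ {t} → FirstOrder t → Linear t → ∀ σ {c} → subst σ t ⟶β c →
                       InnerβStep σ t c
  ⟶β-linear-instance (fvar y) _ σ {c} step = y , c , fv-var , step , ≡-sym (update-same σ y c)
  ⟶β-linear-instance (rigid (head f)) _ σ (top (_ , _ , _ , () , _))
  ⟶β-linear-instance (rigid (rt · fu)) _ σ (top (_ , _ , _ , redex , _)) =
    ⊥-elim (rigid-subst≢redex (rt · fu) σ redex)
  ⟶β-linear-instance {app t u} (rigid (rt · fu)) lin σ (appL step)
    with ⟶β-linear-instance (rigid rt) (λ x → m+n≤o⇒m≤o (occ x t) (lin x)) σ step
  ... | x , s , x∈t , σx⟶s , refl =
    x , s , fv-appL x∈t , σx⟶s ,
    cong (app _) (subst-update-fresh fu σ s (1≤m⇒m+n≤1⇒n≡0 (∈FV⇒1≤occ x∈t) (lin x)))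
  ⟶β-linear-instance {app t u} (rigid (rt · fu)) lin σ (appR step)
    with ⟶β-linear-instance fu (λ x → m+n≤o⇒n≤o (occ x t) (lin x)) σ step
  ... | x , s , x∈u , σx⟶s , refl =
    x , s , fv-appR x∈u , σx⟶s ,
    cong (λ t' → app t' _) (subst-update-fresh (rigid rt) σ s (1≤n⇒m+n≤1⇒m≡0 (∈FV⇒1≤occ x∈u) (lin x)))

  Sim-⟶* : ∀ {E R : Rules {F}} {a b} → Sim E a b → Star (Arrow E R) a b
  Sim-⟶* = map (inj₂ ∘ inj₂)

  Rhd*-⟶* : ∀ {E R : Rules {F}} {a b} → Star (Rhd E R) a b → Star (Arrow E R) a b
  Rhd*-⟶* = Rhd-⟶* ⋆
    where
    Rhd-⟶* : ∀ {E R : Rules {F}} {a b} → Rhd E R a b → Star (Arrow E R) a b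
    Rhd-⟶* (inj₁ β) = return (inj₁ β)
    Rhd-⟶* (inj₂ (_ , a~a' , ρ)) = Sim-⟶* a~a' ◅◅ return (inj₂ (inj₁ ρ))

  module _ {E : Rules {F}}
           (rigid-sides : ∀ {l r} → E l r → Rigid l × Rigid r)
           (linear : LinearEqs E)
           (fv-⊆ : ∀ {l r} → E l r → ∀ x → x ∈FV r → x ∈FV l) where

    private
      firstOrder-sides : ∀ {l r} → E l r → FirstOrder l × FirstOrder r
      firstOrder-sides e = rigid (proj₁ (rigid-sides e)) , rigid (proj₂ (rigid-sides e))

    E-root-β-commute : ∀ {a b c} → RootStep E a b → b ⟶β c → ∃[ d ] (a ⟶β d × Sim E d c)
    E-root-β-commute (l , r , σ , e , refl , refl) step
      with ⟶β-linear-instance (proj₂ (firstOrder-sides e)) (proj₂ (linear l r e)) σ step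
    ... | x , s , x∈r , σx⟶s , refl =
      subst (update σ x s) l ,
      ⟶β-update (proj₁ (firstOrder-sides e)) σ once-in-l σx⟶s ,
      return (top (l , r , update σ x s , e , refl , refl))
      where
      once-in-l : occ x l ≡ 1
      once-in-l = ≤-antisym (proj₁ (linear l r e) x) (∈FV⇒1≤occ (fv-⊆ e x x∈r))

    E-β-root-commute : ∀ {a b c} → a ⟶[ E ] b → RootBeta b c → ∃[ d ] (a ⟶β d × Sim E d c)
    E-β-root-commute (top (l , r , σ , e , refl , redex)) (_ , _ , _ , refl , refl) =
      ⊥-elim (rigid-subst≢redex (proj₂ (rigid-sides e)) σ (≡-sym redex))
    E-β-root-commute (appL (top (l , r , σ , e , refl , eq))) (_ , _ , _ , refl , refl) =
      ⊥-elim (rigid-subst≢lam (proj₂ (rigid-sides e)) σ (≡-sym eq))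
    E-β-root-commute (appL (lamA _)) (_ , v , w , refl , refl) = _ , top (_ , v , w , refl , refl) , ε
    E-β-root-commute (appL (lamB v⟶v')) (U , _ , w , refl , refl) =
      _ , top (U , _ , w , refl , refl) , return (⟶-subst firstOrder-sides (single w) v⟶v')
    E-β-root-commute (appR u⟶w) (U , v , _ , refl , refl) =
      _ , top (U , v , _ , refl , refl) , Sim-subst firstOrder-sides (Sim-single u⟶w) v

    private
      under : ∀ {a c} (f : Term F → Term F) → (∀ {B a b} → Ctx B a b → Ctx B (f a) (f b)) →
              ∃[ d ] (a ⟶β d × Sim E d c) → ∃[ d ] (f a ⟶β d × Sim E d (f c))
      under f C (d , a⟶d , d~c) = f d , C a⟶d , gmap f C d~c

    E-β-commute : ∀ {a b c} → a ⟶[ E ] b → b ⟶β c → ∃[ d ] (a ⟶β d × Sim E d c)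
    E-β-commute (top e) step = E-root-β-commute e step
    E-β-commute p (top β) = E-β-root-commute p β
    E-β-commute (lamA p) (lamA q) = under (λ z → lam z _) lamA (E-β-commute p q)
    E-β-commute (lamA p) (lamB q) = _ , lamB q , return (lamA p)
    E-β-commute (lamB p) (lamA q) = _ , lamA q , return (lamB p)
    E-β-commute (lamB p) (lamB q) = under (lam _) lamB (E-β-commute p q)
    E-β-commute (appL p) (appL q) = under (λ z → app z _) appL (E-β-commute p q)
    E-β-commute (appL p) (appR q) = _ , appR q , return (appL p)
    E-β-commute (appR p) (appL q) = _ , appL q , return (appR p)
    E-β-commute (appR p) (appR q) = under (app _) appR (E-β-commute p q)
    E-β-commute (piA p) (piA q) = under (λ z → pi z _) piA (E-β-commute p q)
    E-β-commute (piA p) (piB q) = _ , piB q , return (piA p)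
    E-β-commute (piB p) (piA q) = _ , piA q , return (piB p)
    E-β-commute (piB p) (piB q) = under (pi _) piB (E-β-commute p q)

    Sim-β-commute : ∀ {a b c} → Sim E a b → b ⟶β c → ∃[ d ] (a ⟶β d × Sim E d c)
    Sim-β-commute ε step = _ , step , ε
    Sim-β-commute (e ◅ b~b') step with Sim-β-commute b~b' step
    ... | d , b⟶d , d~c with E-β-commute e b⟶d
    ... | d' , a⟶d' , d'~d = d' , a⟶d' , d'~d ◅◅ d~c

    module _ {R : Rules {F}} where

      Sim-Rhd*-commute : ∀ {a b c} → Sim E a b → Star (Rhd E R) b c →
                         ∃[ d ] (Star (Rhd E R) a d × Sim E d c)
      Sim-Rhd*-commute a~b ε = _ , ε , a~b
      Sim-Rhd*-commute a~b (inj₁ β ◅ b⟶*c) with Sim-β-commute a~b β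
      ... | d , a⟶d , d~b' with Sim-Rhd*-commute d~b' b⟶*c
      ... | d' , d⟶*d' , d'~c = d' , inj₁ a⟶d ◅ d⟶*d' , d'~c
      Sim-Rhd*-commute a~b (inj₂ (b' , b~b' , ρ) ◅ b⟶*c) with Sim-Rhd*-commute ε b⟶*c
      ... | d , b⟶*d , d~c = d , inj₂ (b' , a~b ◅◅ b~b' , ρ) ◅ b⟶*d , d~c

      ⟶*-Rhd*-Sim : ∀ {a c} → Star (Arrow E R) a c → ∃[ d ] (Star (Rhd E R) a d × Sim E d c)
      ⟶*-Rhd*-Sim ε = _ , ε , ε
      ⟶*-Rhd*-Sim (step ◅ b⟶*c) with ⟶*-Rhd*-Sim b⟶*c
      ⟶*-Rhd*-Sim (inj₁ β ◅ _) | d , b⟶*d , d~c = d , inj₁ β ◅ b⟶*d , d~c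
      ⟶*-Rhd*-Sim (inj₂ (inj₁ ρ) ◅ _) | d , b⟶*d , d~c = d , inj₂ (_ , ε , ρ) ◅ b⟶*d , d~c
      ⟶*-Rhd*-Sim (inj₂ (inj₂ e) ◅ _) | d , b⟶*d , d~c with Sim-Rhd*-commute (return e) b⟶*d
      ... | d' , a⟶*d' , d'~d = d' , a⟶*d' , d'~d ◅◅ d~c

      module _ (symmetric : ∀ l r → E l r → E r l) where

        Arrow-confluent⇒Rhd-confluent : ArrowConfluent E R → RhdSimConfluent E R
        Arrow-confluent⇒Rhd-confluent confluent t u v t⟶*u t⟶*v
          with confluent t u v (Rhd*-⟶* t⟶*u) (Rhd*-⟶* t⟶*v)
        ... | w , u⟶*w , v⟶*w with ⟶*-Rhd*-Sim u⟶*w | ⟶*-Rhd*-Sim v⟶*w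
        ... | u' , u⟶*u' , u'~w | v' , v⟶*v' , v'~w =
          u' , v' , u⟶*u' , v⟶*v' , u'~w ◅◅ Sim-sym symmetric v'~w

        Rhd-confluent⇒Arrow-confluent : RhdSimConfluent E R → ArrowConfluent E R
        Rhd-confluent⇒Arrow-confluent confluent t u v t⟶*u t⟶*v
          with ⟶*-Rhd*-Sim t⟶*u | ⟶*-Rhd*-Sim t⟶*v
        ... | u₁ , t⟶*u₁ , u₁~u | v₁ , t⟶*v₁ , v₁~v with confluent t u₁ v₁ t⟶*u₁ t⟶*v₁
        ... | u₂ , v₂ , u₁⟶*u₂ , v₁⟶*v₂ , u₂~v₂ =
          v₂ ,
          Sim-⟶* (Sim-sym symmetric u₁~u) ◅◅ Rhd*-⟶* u₁⟶*u₂ ◅◅ Sim-⟶* u₂~v₂ ,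
          Sim-⟶* (Sim-sym symmetric v₁~v) ◅◅ Rhd*-⟶* v₁⟶*v₂

        Rhd-confluent⇒on-classes : RhdSimConfluent E R → RhdSimConfluentOnClasses E R
        Rhd-confluent⇒on-classes confluent t t' u v t⟶*u t~t' t'⟶*v
          with Sim-Rhd*-commute (Sim-sym symmetric t~t') t⟶*u
        ... | u₁ , t'⟶*u₁ , u₁~u with confluent t' u₁ v t'⟶*u₁ t'⟶*v
        ... | u₂ , v' , u₁⟶*u₂ , v⟶*v' , u₂~v' with Sim-Rhd*-commute (Sim-sym symmetric u₁~u) u₁⟶*u₂
        ... | u' , u⟶*u' , u'~u₂ = u' , v' , u⟶*u' , v⟶*v' , u'~u₂ ◅◅ u₂~v'

lemma5 : (F : Set) (arity : F → ℕ) (E R : Rules {F}) →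
         IsEquations arity E → IsRewriteRules arity R → LinearEqs E →
         (ArrowConfluent E R ⇔ RhdSimConfluent E R) ×
         (RhdSimConfluent E R ⇔ RhdSimConfluentOnClasses E R)
lemma5 F arity E R (E-rules , symmetric , E-shape) _ linear =
  mk⇔ (Arrow-confluent⇒Rhd-confluent rigid-sides linear fv-⊆ symmetric)
      (Rhd-confluent⇒Arrow-confluent rigid-sides linear fv-⊆ symmetric) ,
  mk⇔ (Rhd-confluent⇒on-classes rigid-sides linear fv-⊆ symmetric)
      (λ confluent t u v t⟶*u t⟶*v → confluent t t u v t⟶*u ε t⟶*v)
  where
  rigid-side : ∀ {t} → Algebraic arity t → ¬ IsVar t → Rigid t
  rigid-side = firstOrder⇒rigid ∘ algebraic⇒firstOrder

  rigid-sides : ∀ {l r} → E l r → Rigid l × Rigid r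
  rigid-sides {l} {r} e =
    rigid-side (proj₁ (E-shape l r e)) (proj₁ (proj₂ (E-rules l r e))) ,
    rigid-side (proj₁ (proj₂ (E-shape l r e))) (proj₁ (proj₂ (E-rules r l (symmetric l r e))))

  fv-⊆ : ∀ {l r} → E l r → ∀ x → x ∈FV r → x ∈FV l
  fv-⊆ {l} {r} e x = Equivalence.from (proj₂ (proj₂ (proj₂ (proj₂ (E-shape l r e)))) x)
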